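{- Let $G$ be a graph, let $\eta$ be a non-singular index function of $G$, and let $E'\subseteq E(G)$ be such that $\eta(e)=0$ for every $e\in E'$. Then the restriction of $\eta$ to $V(G)\cup (E(G)\setminus E')$ is a non-singular index function of $G-E'$.
   Context: Graphs are finite and simple; $E(v)$ denotes the set of edges incident to $v$. For a graph $H$, fix an orientation $D$ of $H$ and a variable $x_z$ for every $z\in V(H)\cup E(H)$, and let $$P_H=\prod_{(u,v)\in E(D)}\Big(\big(\textstyle\sum_{e\in E(u)}x_e+x_u\big)-\big(\sum_{e\in E(v)}x_e+x_v\big)\Big),$$ where $E(\cdot)$ refers to edges of $H$. An index function of $H$ is a map $\eta: V(H)\cup E(H)\to\{0,1,2,\dots\}$; it is valid if $\sum_z\eta(z)=|E(H)|$. For valid $\eta$, $c_\eta$ is the coefficient of $\prod_z x_z^{\eta(z)}$ in $P_H$. An index function $\eta$ is non-singular if there is a valid index function $\eta'\le\eta$ (pointwise) with $c_{\eta'}\ne 0$. (This does not depend on the orientation.) -}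

module Defs where

open import Data.Nat using (ℕ; _≤_)
open import Data.Fin using (Fin) renaming (_<_ to _<ᶠ_; _≟_ to _≟ᶠ_)
open import Data.Integer using (ℤ; 0ℤ; 1ℤ; -_) renaming (_+_ to _+ℤ_; _*_ to _*ℤ_)
open import Data.List using (List; []; _∷_; allFin; _++_; map; concatMap; filter; foldr; length)
open import Data.Nat.ListAction using (sum)
open import Data.List.Relation.Unary.All using (All; all?)
open import Data.List.Relation.Unary.Unique.Propositional using (Unique)
open import Data.List.Relation.Unary.All.Properties as AllP using ()
open import Data.List.Relation.Unary.Unique.Propositional.Properties as UniqP using ()
open import Data.List.Membership.Propositional using (_∈_)
open import Data.List.Membership.DecPropositional using () renaming (_∈?_ to mem?)
open import Data.Product using (_×_; _,_; proj₁; proj₂; ∃)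
open import Data.Sum using (_⊎_; inj₁; inj₂)
import Data.Sum.Properties as SumP
import Data.Product.Properties as ProdP
open import Relation.Binary.PropositionalEquality using (_≡_; _≢_)
open import Relation.Binary.Definitions using (DecidableEquality)
open import Relation.Nullary using (Dec; ¬_; ¬?; does)
open import Data.Bool using (Bool; if_then_else_)

-- An edge {u,v} is stored as the pair (u , v) with u < v; the edge list
-- has no repetitions.  The stored pair also fixes the orientation D
-- (u → v) used to build P_H (the notion does not depend on it).

Edge : ℕ → Set
Edge n = Fin n × Fin n

_≟ᴱ_ : ∀ {n} → DecidableEquality (Edge n)
_≟ᴱ_ = ProdP.≡-dec _≟ᶠ_ _≟ᶠ_

record Graph (n : ℕ) : Set where
  field
    edges   : List (Edge n)
    ordered : All (λ e → proj₁ e <ᶠ proj₂ e) edges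
    unique  : Unique edges
open Graph public

_∖_ : ∀ {n} → Graph n → List (Edge n) → Graph n
_∖_ {n} G E' = record
  { edges   = filter P? (edges G)
  ; ordered = AllP.filter⁺ P? (ordered G)
  ; unique  = UniqP.filter⁺ P? (unique G)
  }
  where
  P? : (e : Edge n) → Dec (¬ (e ∈ E'))
  P? e = ¬? (mem? _≟ᴱ_ e E')

-- Variables x_z for z ∈ V(H) ∪ E(H): vertices are inj₁ v, edges inj₂ e.

Var : ℕ → Set
Var n = Fin n ⊎ Edge n

_≟ⱽ_ : ∀ {n} → DecidableEquality (Var n)
_≟ⱽ_ = SumP.≡-dec _≟ᶠ_ _≟ᴱ_

vars : ∀ {n} → Graph n → List (Var n)
vars {n} H = map inj₁ (allFin n) ++ map inj₂ (edges H)

-- Polynomials in ℤ[x_z] as (unnormalised) formal sums of terms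
-- c · x_{z1} x_{z2} ⋯ x_{zk}; a monomial is the list of its factors.

Term : ℕ → Set
Term n = ℤ × List (Var n)

Poly : ℕ → Set
Poly n = List (Term n)

pvar : ∀ {n} → Var n → Poly n
pvar z = (1ℤ , z ∷ []) ∷ []

pone : ∀ {n} → Poly n
pone = (1ℤ , []) ∷ []

padd : ∀ {n} → Poly n → Poly n → Poly n
padd p q = p ++ q

pneg : ∀ {n} → Poly n → Poly n
pneg = map (λ t → (- proj₁ t) , proj₂ t)

pmul : ∀ {n} → Poly n → Poly n → Poly n
pmul p q = concatMap (λ t → map (λ s → (proj₁ t *ℤ proj₁ s) , (proj₂ t ++ proj₂ s)) q) p

incident? : ∀ {n} (u : Fin n) (e : Edge n) → Dec (u ≡ proj₁ e ⊎ u ≡ proj₂ e)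
incident? u e = Relation.Nullary.Decidable._⊎-dec_ (u ≟ᶠ proj₁ e) (u ≟ᶠ proj₂ e)
  where import Relation.Nullary.Decidable

Lform : ∀ {n} → Graph n → Fin n → Poly n
Lform H u = padd (concatMap (λ e → pvar (inj₂ e)) (filter (incident? u) (edges H))) (pvar (inj₁ u))

P : ∀ {n} → Graph n → Poly n
P H = foldr (λ e acc → pmul (padd (Lform H (proj₁ e)) (pneg (Lform H (proj₂ e)))) acc) pone (edges H)

IndexFn : ℕ → Set
IndexFn n = Var n → ℕ

count : ∀ {n} → Var n → List (Var n) → ℕ
count z m = length (filter (z ≟ⱽ_) m)

-- monomial m equals ∏_{z ∈ V(H) ∪ E(H)} x_z^{η(z)}
-- (all variables occurring in P_H lie in V(H) ∪ E(H))
matches? : ∀ {n} (H : Graph n) (η : IndexFn n) (m : List (Var n)) →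
           Dec (All (λ z → count z m ≡ η z) (vars H))
matches? H η m = all? (λ z → Data.Nat._≟_ (count z m) (η z)) (vars H)
  where import Data.Nat

coeff : ∀ {n} → Graph n → IndexFn n → ℤ
coeff H η = foldr (λ t acc → (if does (matches? H η (proj₂ t)) then proj₁ t else 0ℤ) +ℤ acc)
                  0ℤ (P H)

Valid : ∀ {n} → Graph n → IndexFn n → Set
Valid H η = sum (map η (vars H)) ≡ length (edges H)

_≤[_]_ : ∀ {n} → IndexFn n → Graph n → IndexFn n → Set
η' ≤[ H ] η = All (λ z → η' z ≤ η z) (vars H)

NonSingular : ∀ {n} → Graph n → IndexFn n → Set
NonSingular H η = ∃ λ η' → Valid H η' × (η' ≤[ H ] η) × (coeff H η' ≢ 0ℤ)

-- Since η vanishes on E', so does every valid η' ≤ η with c_η' ≠ 0; hence monomials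
-- containing an edge variable of E' do not contribute to c_η', and setting those variables
-- to zero leaves c_η' unchanged.  The substitution turns every factor L_G(u) − L_G(v) of
-- P_G into L_{G-E'}(u) − L_{G-E'}(v), so P_G becomes R · P_{G-E'}, where R is the product
-- of the factors belonging to the edges of E'.  The coefficient of x^η' in R · P_{G-E'} is
-- the sum, over the terms c·x^m of R, of c · [x^{η'-m}] P_{G-E'}; one of these is nonzero,
-- and η' − m ≤ η' ≤ η is valid for G-E' because P_{G-E'} is homogeneous of degree
-- |E(G-E')|.
module Submission where

open import Defs
open import Algebra.Properties.CommutativeSemigroup using (interchange)
open import Data.Empty using (⊥)
open import Data.Integer using (ℤ; 0ℤ) renaming (_+_ to _+ℤ_; _*_ to _*ℤ_)
import Data.Integer.Properties as ℤ
open import Data.List using (List; []; _∷_; _++_; map; concatMap; filter; foldr; length; allFin)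
open import Data.List.Properties
  using (++-assoc; map-++; map-cong; map-cong-local; map-∘; length-++; foldr-map; concatMap-++;
         filter-++; filter-accept; filter-reject; filter-none; filter-some)
open import Data.List.Membership.Propositional using (_∈_; _∉_)
open import Data.List.Membership.DecPropositional using () renaming (_∈?_ to mem?)
import Data.List.Membership.Propositional.Properties as ∈
open import Data.List.Relation.Binary.Subset.Propositional using (_⊆_)
import Data.List.Relation.Binary.Subset.Propositional.Properties as ⊆
open import Data.List.Relation.Unary.All as All using (All; []; _∷_; all?)
import Data.List.Relation.Unary.All.Properties as All
open import Data.List.Relation.Unary.AllPairs using (_∷_)
open import Data.List.Relation.Unary.Any using (here; there)
open import Data.List.Relation.Unary.Unique.Propositional using (Unique)
import Data.List.Relation.Unary.Unique.Propositional.Properties as Unique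
open import Data.Nat using (ℕ; suc; _+_; _∸_; _≤_; _<_; _≤?_)
open import Data.Nat.ListAction using (sum)
import Data.Nat.Properties as ℕ
open import Data.Product using (_×_; _,_; proj₁; proj₂; ∃)
open import Data.Sum using (_⊎_; inj₁; inj₂; [_,_]′)
open import Data.Sum.Properties using (inj₁-injective; inj₂-injective)
open import Data.Bool using (Bool; true; false; if_then_else_)
open import Function using (_∘_; _⇔_; mk⇔; Equivalence)
open import Relation.Binary.PropositionalEquality
  using (_≡_; _≢_; refl; sym; trans; cong; cong₂; subst; module ≡-Reasoning)
open import Relation.Nullary using (Dec; yes; no; ¬_; ¬?; does; contradiction)
open import Relation.Nullary.Decidable using (does-⇔)
open import Relation.Unary using (Decidable)

open ≡-Reasoning

sumℤ : {A : Set} → (A → ℤ) → List A → ℤ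
sumℤ f = foldr (λ x acc → f x +ℤ acc) 0ℤ

module _ {A : Set} where

  sumℤ-++ : ∀ (f : A → ℤ) xs ys → sumℤ f (xs ++ ys) ≡ sumℤ f xs +ℤ sumℤ f ys
  sumℤ-++ f []       ys = sym (ℤ.+-identityˡ _)
  sumℤ-++ f (x ∷ xs) ys = trans (cong (f x +ℤ_) (sumℤ-++ f xs ys)) (sym (ℤ.+-assoc (f x) _ _))

  sumℤ-cong-local : ∀ {f g : A → ℤ} {xs} → All (λ x → f x ≡ g x) xs → sumℤ f xs ≡ sumℤ g xs
  sumℤ-cong-local []            = refl
  sumℤ-cong-local (fx≡gx ∷ eqs) = cong₂ _+ℤ_ fx≡gx (sumℤ-cong-local eqs)

  sumℤ-cong : ∀ {f g : A → ℤ} → (∀ x → f x ≡ g x) → ∀ xs → sumℤ f xs ≡ sumℤ g xs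
  sumℤ-cong f≗g xs = sumℤ-cong-local (All.universal f≗g xs)

  sumℤ-zero : ∀ {f : A → ℤ} {xs} → All (λ x → f x ≡ 0ℤ) xs → sumℤ f xs ≡ 0ℤ
  sumℤ-zero []           = refl
  sumℤ-zero (fx≡0 ∷ eqs) = cong₂ _+ℤ_ fx≡0 (sumℤ-zero eqs)

  sumℤ-+ : ∀ (f g : A → ℤ) xs → sumℤ (λ x → f x +ℤ g x) xs ≡ sumℤ f xs +ℤ sumℤ g xs
  sumℤ-+ f g []       = refl
  sumℤ-+ f g (x ∷ xs) =
    trans (cong (f x +ℤ g x +ℤ_) (sumℤ-+ f g xs))
          (interchange ℤ.+-commutativeSemigroup (f x) (g x) _ _)

  sumℤ-*ˡ : ∀ c (f : A → ℤ) xs → sumℤ (λ x → c *ℤ f x) xs ≡ c *ℤ sumℤ f xs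
  sumℤ-*ˡ c f []       = sym (ℤ.*-zeroʳ c)
  sumℤ-*ˡ c f (x ∷ xs) = trans (cong (c *ℤ f x +ℤ_) (sumℤ-*ˡ c f xs)) (sym (ℤ.*-distribˡ-+ c _ _))

  sumℤ-filter : ∀ {P : A → Set} (P? : Decidable P) {f : A → ℤ} →
                (∀ x → ¬ P x → f x ≡ 0ℤ) → ∀ xs → sumℤ f (filter P? xs) ≡ sumℤ f xs
  sumℤ-filter P? f0 []       = refl
  sumℤ-filter P? {f} f0 (x ∷ xs) with P? x
  ... | yes _  = cong (f x +ℤ_) (sumℤ-filter P? f0 xs)
  ... | no ¬px = begin
    sumℤ f (filter P? xs)  ≡⟨ sumℤ-filter P? f0 xs ⟩
    sumℤ f xs              ≡⟨ sym (ℤ.+-identityˡ _) ⟩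
    0ℤ +ℤ sumℤ f xs        ≡⟨ cong (_+ℤ sumℤ f xs) (sym (f0 x ¬px)) ⟩
    f x +ℤ sumℤ f xs       ∎

  sumℤ≢0⇒∃ : ∀ (f : A → ℤ) xs → sumℤ f xs ≢ 0ℤ → ∃ λ x → x ∈ xs × f x ≢ 0ℤ
  sumℤ≢0⇒∃ f []       ne = contradiction refl ne
  sumℤ≢0⇒∃ f (x ∷ xs) ne with f x ℤ.≟ 0ℤ
  ... | no fx≢0  = x , here refl , fx≢0
  ... | yes fx≡0 with sumℤ≢0⇒∃ f xs (ne ∘ cong₂ _+ℤ_ fx≡0)
  ...   | y , y∈xs , fy≢0 = y , there y∈xs , fy≢0

sumℤ-swap : ∀ {A B : Set} (g : A → B → ℤ) xs ys →
            sumℤ (λ x → sumℤ (g x) ys) xs ≡ sumℤ (λ y → sumℤ (λ x → g x y) xs) ys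
sumℤ-swap g []       ys = sym (sumℤ-zero (All.universal (λ _ → refl) ys))
sumℤ-swap g (x ∷ xs) ys =
  trans (cong (sumℤ (g x) ys +ℤ_) (sumℤ-swap g xs ys))
        (sym (sumℤ-+ (g x) (λ y → sumℤ (λ x → g x y) xs) ys))

sumℤ-map : ∀ {A B : Set} (f : B → ℤ) (g : A → B) xs → sumℤ f (map g xs) ≡ sumℤ (f ∘ g) xs
sumℤ-map f g = foldr-map _ g 0ℤ

sumℤ-concatMap : ∀ {A B : Set} (f : B → ℤ) (g : A → List B) xs →
                 sumℤ f (concatMap g xs) ≡ sumℤ (λ x → sumℤ f (g x)) xs
sumℤ-concatMap f g []       = refl
sumℤ-concatMap f g (x ∷ xs) =
  trans (sumℤ-++ f (g x) _) (cong (sumℤ f (g x) +ℤ_) (sumℤ-concatMap f g xs))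

-- Polynomial arithmetic on the list representation

module _ {n : ℕ} where

  termMul : Term n → Term n → Term n
  termMul t s = proj₁ t *ℤ proj₁ s , proj₂ t ++ proj₂ s

  termMul-assoc : ∀ t s u → termMul (termMul t s) u ≡ termMul t (termMul s u)
  termMul-assoc (c , m) (c′ , m′) (c″ , m″) = cong₂ _,_ (ℤ.*-assoc c c′ c″) (++-assoc m m′ m″)

  pmul-map-termMul : ∀ t q r → pmul (map (termMul t) q) r ≡ map (termMul t) (pmul q r)
  pmul-map-termMul t []      r = refl
  pmul-map-termMul t (s ∷ q) r = begin
    map (termMul (termMul t s)) r ++ pmul (map (termMul t) q) r
      ≡⟨ cong₂ _++_ (trans (map-cong (termMul-assoc t s) r) (map-∘ r)) (pmul-map-termMul t q r) ⟩
    map (termMul t) (map (termMul s) r) ++ map (termMul t) (pmul q r)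
      ≡⟨ sym (map-++ (termMul t) (map (termMul s) r) _) ⟩
    map (termMul t) (map (termMul s) r ++ pmul q r) ∎

  pmul-assoc : ∀ (p q r : Poly n) → pmul (pmul p q) r ≡ pmul p (pmul q r)
  pmul-assoc []      q r = refl
  pmul-assoc (t ∷ p) q r = begin
    pmul (map (termMul t) q ++ pmul p q) r
      ≡⟨ concatMap-++ _ (map (termMul t) q) (pmul p q) ⟩
    pmul (map (termMul t) q) r ++ pmul (pmul p q) r
      ≡⟨ cong₂ _++_ (pmul-map-termMul t q r) (pmul-assoc p q r) ⟩
    map (termMul t) (pmul q r) ++ pmul p (pmul q r) ∎

prod : ∀ {n} {A : Set} → (A → Poly n) → List A → Poly n
prod f = foldr (λ x acc → pmul (f x) acc) pone

factor : ∀ {n} → Graph n → Edge n → Poly n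
factor H e = padd (Lform H (proj₁ e)) (pneg (Lform H (proj₂ e)))

module _ {n : ℕ} where

  count-++ : ∀ (z : Var n) m m′ → count z (m ++ m′) ≡ count z m + count z m′
  count-++ z m m′ = trans (cong length (filter-++ (z ≟ⱽ_) m m′)) (length-++ (filter (z ≟ⱽ_) m))

  count-++-comm : ∀ (z : Var n) m m′ → count z (m ++ m′) ≡ count z (m′ ++ m)
  count-++-comm z m m′ =
    trans (count-++ z m m′) (trans (ℕ.+-comm (count z m) _) (sym (count-++ z m′ m)))

  count-∉ : ∀ {z : Var n} {m} → z ∉ m → count z m ≡ 0
  count-∉ {z} {m} z∉m = cong length (filter-none (z ≟ⱽ_) (All.¬Any⇒All¬ m z∉m))

  count-singleton-≢ : ∀ {z x : Var n} → z ≢ x → count z (x ∷ []) ≡ 0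
  count-singleton-≢ {z} {x} z≢x = count-∉ {z = z} {x ∷ []} λ { (here z≡x) → z≢x z≡x }

  count-∈ : ∀ {z : Var n} {m} → z ∈ m → 0 < count z m
  count-∈ {z} = filter-some (z ≟ⱽ_)

  _∸ᵐ_ : IndexFn n → List (Var n) → IndexFn n
  (α ∸ᵐ m) z = α z ∸ count z m

-- Coefficients of polynomials in the variables of a graph

if-*ˡ : ∀ (b : Bool) c c′ → (if b then c *ℤ c′ else 0ℤ) ≡ c *ℤ (if b then c′ else 0ℤ)
if-*ˡ true  c c′ = refl
if-*ˡ false c c′ = sym (ℤ.*-zeroʳ c)

m+n≡o⇔n≡o∸m : ∀ {m n o} → m ≤ o → (m + n ≡ o) ⇔ (n ≡ o ∸ m)
m+n≡o⇔n≡o∸m {m} {n} m≤o = mk⇔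
  (λ m+n≡o → trans (sym (ℕ.m+n∸m≡n m n)) (cong (_∸ m) m+n≡o))
  (λ n≡o∸m → trans (cong (m +_) n≡o∸m) (ℕ.m+[n∸m]≡n m≤o))

module Coefficient {n : ℕ} (H : Graph n) where

  Matches : IndexFn n → List (Var n) → Set
  Matches α m = All (λ z → count z m ≡ α z) (vars H)

  Divides : List (Var n) → IndexFn n → Set
  Divides m α = All (λ z → count z m ≤ α z) (vars H)

  divides? : ∀ m α → Dec (Divides m α)
  divides? m α = all? (λ z → count z m ≤? α z) (vars H)

  termCoeff : IndexFn n → Term n → ℤ
  termCoeff α t = if does (matches? H α (proj₂ t)) then proj₁ t else 0ℤ

  coeffOf : IndexFn n → Poly n → ℤ
  coeffOf α = sumℤ (termCoeff α)

  termCoeff-¬matches : ∀ {α} t → ¬ Matches α (proj₂ t) → termCoeff α t ≡ 0ℤ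
  termCoeff-¬matches {α} (c , m) ¬mt with matches? H α m
  ... | yes mt = contradiction mt ¬mt
  ... | no  _  = refl

  coeffOf≢0⇒matching : ∀ {α} p → coeffOf α p ≢ 0ℤ → ∃ λ t → t ∈ p × Matches α (proj₂ t)
  coeffOf≢0⇒matching {α} p ne with sumℤ≢0⇒∃ (termCoeff α) p ne
  ... | (c , m) , t∈p , tc≢0 with matches? H α m
  ...   | yes mt = (c , m) , t∈p , mt
  ...   | no  _  = contradiction refl tc≢0

  matches-++⇒divides : ∀ {α} m {m′} → Matches α (m ++ m′) → Divides m α
  matches-++⇒divides m {m′} = All.map λ {z} eq →
    ℕ.m+n≤o⇒m≤o (count z m) (ℕ.≤-reflexive (trans (sym (count-++ z m m′)) eq))

  matches-++⇔ : ∀ {α} m m′ → Divides m α → Matches α (m ++ m′) ⇔ Matches (α ∸ᵐ m) m′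
  matches-++⇔ {α} m m′ m∣α = mk⇔
    (λ mt  → All.zipWith (λ (le , eq) → Equivalence.to   (at le) eq) (m∣α , mt))
    (λ mt′ → All.zipWith (λ (le , eq) → Equivalence.from (at le) eq) (m∣α , mt′))
    where
    at : ∀ {z} → count z m ≤ α z → (count z (m ++ m′) ≡ α z) ⇔ (count z m′ ≡ α z ∸ count z m)
    at {z} le = subst (λ k → (k ≡ α z) ⇔ (count z m′ ≡ α z ∸ count z m)) (sym (count-++ z m m′))
                      (m+n≡o⇔n≡o∸m le)

  termCoeff-termMul : ∀ {α} c m → Divides m α → ∀ s →
                      termCoeff α (termMul (c , m) s) ≡ c *ℤ termCoeff (α ∸ᵐ m) s
  termCoeff-termMul {α} c m m∣α (c′ , m′) = begin
    (if does (matches? H α (m ++ m′)) then c *ℤ c′ else 0ℤ)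
      ≡⟨ cong (λ b → if b then c *ℤ c′ else 0ℤ)
              (does-⇔ (matches-++⇔ m m′ m∣α) (matches? H α (m ++ m′)) (matches? H (α ∸ᵐ m) m′)) ⟩
    (if does (matches? H (α ∸ᵐ m) m′) then c *ℤ c′ else 0ℤ)
      ≡⟨ if-*ˡ _ c c′ ⟩
    c *ℤ termCoeff (α ∸ᵐ m) (c′ , m′) ∎

  termCoeff-termMul-comm : ∀ {α} t s → termCoeff α (termMul t s) ≡ termCoeff α (termMul s t)
  termCoeff-termMul-comm {α} (c , m) (c′ , m′) =
    cong₂ (λ b x → if b then x else 0ℤ)
          (does-⇔ (mk⇔ (swap m m′) (swap m′ m)) (matches? H α (m ++ m′)) (matches? H α (m′ ++ m)))
          (ℤ.*-comm c c′)
    where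
    swap : ∀ a b → Matches α (a ++ b) → Matches α (b ++ a)
    swap a b = All.map (λ {z} → trans (count-++-comm z b a))

  coeffOf-pmul-expand : ∀ α p q →
    coeffOf α (pmul p q) ≡ sumℤ (λ t → sumℤ (λ s → termCoeff α (termMul t s)) q) p
  coeffOf-pmul-expand α p q =
    trans (sumℤ-concatMap (termCoeff α) (λ t → map (termMul t) q) p)
          (sumℤ-cong (λ t → sumℤ-map (termCoeff α) (termMul t) q) p)

  contribution : IndexFn n → Poly n → Term n → ℤ
  contribution α q (c , m) with divides? m α
  ... | yes _ = c *ℤ coeffOf (α ∸ᵐ m) q
  ... | no  _ = 0ℤ

  sum-termMul≡contribution : ∀ α t q →
    sumℤ (λ s → termCoeff α (termMul t s)) q ≡ contribution α q t
  sum-termMul≡contribution α (c , m) q with divides? m α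
  ... | yes m∣α = trans (sumℤ-cong (termCoeff-termMul c m m∣α) q) (sumℤ-*ˡ c _ q)
  ... | no ¬m∣α = sumℤ-zero (All.universal (λ s →
                    termCoeff-¬matches (termMul (c , m) s) (¬m∣α ∘ matches-++⇒divides m)) q)

  coeffOf-pmul : ∀ α p q → coeffOf α (pmul p q) ≡ sumℤ (contribution α q) p
  coeffOf-pmul α p q =
    trans (coeffOf-pmul-expand α p q) (sumℤ-cong (λ t → sum-termMul≡contribution α t q) p)

  coeffOf-pmul≢0 : ∀ {α} p q → coeffOf α (pmul p q) ≢ 0ℤ → ∃ λ m → coeffOf (α ∸ᵐ m) q ≢ 0ℤ
  coeffOf-pmul≢0 {α} p q ne with sumℤ≢0⇒∃ (contribution α q) p (ne ∘ trans (coeffOf-pmul α p q))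
  ... | (c , m) , _ , ct≢0 with divides? m α
  ...   | yes _ = m , λ co≡0 → ct≢0 (trans (cong (c *ℤ_) co≡0) (ℤ.*-zeroʳ c))
  ...   | no  _ = contradiction refl ct≢0

  _≈_ : Poly n → Poly n → Set
  p ≈ q = ∀ α → coeffOf α p ≡ coeffOf α q

  pmul-congʳ : ∀ p {q q′} → q ≈ q′ → pmul p q ≈ pmul p q′
  pmul-congʳ p {q} {q′} q≈q′ α = begin
    coeffOf α (pmul p q)        ≡⟨ coeffOf-pmul α p q ⟩
    sumℤ (contribution α q) p  ≡⟨ sumℤ-cong contribution-cong p ⟩
    sumℤ (contribution α q′) p ≡⟨ sym (coeffOf-pmul α p q′) ⟩
    coeffOf α (pmul p q′)       ∎
    where
    contribution-cong : ∀ t → contribution α q t ≡ contribution α q′ t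
    contribution-cong (c , m) with divides? m α
    ... | yes _ = cong (c *ℤ_) (q≈q′ (α ∸ᵐ m))
    ... | no  _ = refl

  pmul-comm : ∀ p q → pmul p q ≈ pmul q p
  pmul-comm p q α = begin
    coeffOf α (pmul p q)
      ≡⟨ coeffOf-pmul-expand α p q ⟩
    sumℤ (λ t → sumℤ (λ s → termCoeff α (termMul t s)) q) p
      ≡⟨ sumℤ-swap (λ t s → termCoeff α (termMul t s)) p q ⟩
    sumℤ (λ s → sumℤ (λ t → termCoeff α (termMul t s)) p) q
      ≡⟨ sumℤ-cong (λ s → sumℤ-cong (λ t → termCoeff-termMul-comm t s) p) q ⟩
    sumℤ (λ s → sumℤ (λ t → termCoeff α (termMul s t)) p) q
      ≡⟨ sym (coeffOf-pmul-expand α q p) ⟩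
    coeffOf α (pmul q p) ∎

  prod-partition : ∀ {A : Set} (f : A → Poly n) {P : A → Set} (P? : Decidable P) xs →
                   prod f xs ≈ pmul (prod f (filter P? xs)) (prod f (filter (¬? ∘ P?) xs))
  prod-partition f P? []       α = refl
  prod-partition f P? (x ∷ xs) α with P? x
  ... | yes _ = begin
    coeffOf α (pmul (f x) (prod f xs))       ≡⟨ pmul-congʳ (f x) (prod-partition f P? xs) α ⟩
    coeffOf α (pmul (f x) (pmul Pxs ¬Pxs))   ≡⟨ cong (coeffOf α) (sym (pmul-assoc (f x) Pxs ¬Pxs)) ⟩
    coeffOf α (pmul (pmul (f x) Pxs) ¬Pxs)   ∎
    where
    Pxs ¬Pxs : Poly n
    Pxs  = prod f (filter P? xs)
    ¬Pxs = prod f (filter (¬? ∘ P?) xs)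
  ... | no _ = begin
    coeffOf α (pmul (f x) (prod f xs))       ≡⟨ pmul-congʳ (f x) (prod-partition f P? xs) α ⟩
    coeffOf α (pmul (f x) (pmul Pxs ¬Pxs))   ≡⟨ pmul-comm (f x) (pmul Pxs ¬Pxs) α ⟩
    coeffOf α (pmul (pmul Pxs ¬Pxs) (f x))   ≡⟨ cong (coeffOf α) (pmul-assoc Pxs ¬Pxs (f x)) ⟩
    coeffOf α (pmul Pxs (pmul ¬Pxs (f x)))   ≡⟨ pmul-congʳ Pxs (pmul-comm ¬Pxs (f x)) α ⟩
    coeffOf α (pmul Pxs (pmul (f x) ¬Pxs))   ∎
    where
    Pxs ¬Pxs : Poly n
    Pxs  = prod f (filter P? xs)
    ¬Pxs = prod f (filter (¬? ∘ P?) xs)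

open Coefficient using (coeffOf; coeffOf≢0⇒matching; coeffOf-pmul≢0; prod-partition)

-- Setting a decidable set Z of variables to zero

module Zeroing {n : ℕ} {Z : Var n → Set} (Z? : Decidable Z) where

  Avoids : List (Var n) → Set
  Avoids = All (¬_ ∘ Z)

  avoids? : Decidable Avoids
  avoids? = all? (¬? ∘ Z?)

  zeroed : Poly n → Poly n
  zeroed = filter (avoids? ∘ proj₂)

  zeroed-pneg : ∀ p → zeroed (pneg p) ≡ pneg (zeroed p)
  zeroed-pneg []            = refl
  zeroed-pneg ((c , m) ∷ p) with avoids? m
  ... | yes _ = cong (_ ∷_) (zeroed-pneg p)
  ... | no  _ = zeroed-pneg p

  zeroed-map-termMul : ∀ c {m} → Avoids m → ∀ q →
                       zeroed (map (termMul (c , m)) q) ≡ map (termMul (c , m)) (zeroed q)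
  zeroed-map-termMul c am []                 = refl
  zeroed-map-termMul c {m} am ((c′ , m′) ∷ q) with avoids? m′
  ... | yes am′ = trans (filter-accept (avoids? ∘ proj₂) (All.++⁺ am am′))
                        (cong (_ ∷_) (zeroed-map-termMul c am q))
  ... | no ¬am′ = trans (filter-reject (avoids? ∘ proj₂) (¬am′ ∘ All.++⁻ʳ m))
                        (zeroed-map-termMul c am q)

  zeroed-map-termMul-¬avoids : ∀ c {m} → ¬ Avoids m → ∀ q → zeroed (map (termMul (c , m)) q) ≡ []
  zeroed-map-termMul-¬avoids c {m} ¬am q =
    filter-none (avoids? ∘ proj₂) (All.map⁺ (All.universal (λ _ → ¬am ∘ All.++⁻ˡ m) q))

  zeroed-pmul : ∀ p q → zeroed (pmul p q) ≡ pmul (zeroed p) (zeroed q)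
  zeroed-pmul []            q = refl
  zeroed-pmul ((c , m) ∷ p) q with avoids? m
  ... | yes am = trans (filter-++ (avoids? ∘ proj₂) (map (termMul (c , m)) q) (pmul p q))
                       (cong₂ _++_ (zeroed-map-termMul c am q) (zeroed-pmul p q))
  ... | no ¬am = trans (filter-++ (avoids? ∘ proj₂) (map (termMul (c , m)) q) (pmul p q))
                       (cong₂ _++_ (zeroed-map-termMul-¬avoids c ¬am q) (zeroed-pmul p q))

  zeroed-prod : ∀ {A : Set} (f g : A → Poly n) → (∀ x → zeroed (f x) ≡ g x) →
                ∀ xs → zeroed (prod f xs) ≡ prod g xs
  zeroed-prod f g f≗g []       = refl
  zeroed-prod f g f≗g (x ∷ xs) =
    trans (zeroed-pmul (f x) (prod f xs)) (cong₂ pmul (f≗g x) (zeroed-prod f g f≗g xs))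

  count-avoided : ∀ {z m} → Avoids m → Z z → count z m ≡ 0
  count-avoided am zZ = count-∉ (λ z∈m → All.lookup am z∈m zZ)

  module _ (H : Graph n) where
    open Coefficient H using (Matches; termCoeff-¬matches)

    matches⇒avoids : ∀ {α m} → (∀ {z} → Z z → z ∈ vars H) → (∀ {z} → Z z → α z ≡ 0) →
                     Matches α m → Avoids m
    matches⇒avoids Z⊆H α-Z mt = All.tabulate λ z∈m zZ →
      ℕ.<⇒≢ (count-∈ z∈m) (sym (trans (All.lookup mt (Z⊆H zZ)) (α-Z zZ)))

    coeffOf-zeroed : ∀ {α} → (∀ {z} → Z z → z ∈ vars H) → (∀ {z} → Z z → α z ≡ 0) →
                     ∀ p → coeffOf H α (zeroed p) ≡ coeffOf H α p
    coeffOf-zeroed Z⊆H α-Z = sumℤ-filter (avoids? ∘ proj₂)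
      (λ t ¬at → termCoeff-¬matches t (¬at ∘ matches⇒avoids Z⊆H α-Z))

  coeffOf-zeroed-vars : ∀ (H H′ : Graph n) {γ} → vars H′ ⊆ vars H →
                        (∀ {z} → z ∈ vars H → z ∈ vars H′ ⊎ Z z) → (∀ {z} → Z z → γ z ≡ 0) →
                        ∀ p → coeffOf H γ (zeroed p) ≡ coeffOf H′ γ (zeroed p)
  coeffOf-zeroed-vars H H′ {γ} H′⊆H cover γ-Z p =
    sumℤ-cong-local (All.map termCoeff-eq (All.all-filter (avoids? ∘ proj₂) p))
    where
    module C = Coefficient H
    module C′ = Coefficient H′
    termCoeff-eq : ∀ {t} → Avoids (proj₂ t) → C.termCoeff γ t ≡ C′.termCoeff γ t
    termCoeff-eq {c , m} am =
      cong (λ b → if b then c else 0ℤ)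
           (does-⇔ (mk⇔ restrict extend) (matches? H γ m) (matches? H′ γ m))
      where
      restrict : C.Matches γ m → C′.Matches γ m
      restrict = All.anti-mono H′⊆H
      extend : C′.Matches γ m → C.Matches γ m
      extend mt′ = All.tabulate λ z∈H →
        [ All.lookup mt′ , (λ zZ → trans (count-avoided am zZ) (sym (γ-Z zZ))) ]′ (cover z∈H)

-- Homogeneity of P_H, and validity of its nonzero coefficients

module _ {n : ℕ} where

  HomogeneousTerm : List (Var n) → ℕ → Term n → Set
  HomogeneousTerm V k t = All (_∈ V) (proj₂ t) × length (proj₂ t) ≡ k

  termMul-homogeneous : ∀ {V j k} t s → HomogeneousTerm V j t → HomogeneousTerm V k s →
                        HomogeneousTerm V (j + k) (termMul t s)
  termMul-homogeneous t s (t⊆V , |t|) (s⊆V , |s|) =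
    All.++⁺ t⊆V s⊆V , trans (length-++ (proj₂ t)) (cong₂ _+_ |t| |s|)

  pmul-homogeneous : ∀ {V j k p q} → All (HomogeneousTerm V j) p → All (HomogeneousTerm V k) q →
                     All (HomogeneousTerm V (j + k)) (pmul p q)
  pmul-homogeneous hp hq = All.concat⁺ (All.map⁺ (All.map (λ {t} ht →
    All.map⁺ (All.map (λ {s} → termMul-homogeneous t s ht) hq)) hp))

  prod-homogeneous : ∀ {V} {A : Set} {f : A → Poly n} → (∀ x → All (HomogeneousTerm V 1) (f x)) →
                     ∀ xs → All (HomogeneousTerm V (length xs)) (prod f xs)
  prod-homogeneous hf []       = ([] , refl) ∷ []
  prod-homogeneous hf (x ∷ xs) = pmul-homogeneous (hf x) (prod-homogeneous hf xs)

  vertex-∈-vars : ∀ (H : Graph n) u → inj₁ u ∈ vars H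
  vertex-∈-vars H u = ∈.∈-++⁺ˡ (∈.∈-map⁺ inj₁ (∈.∈-allFin u))

  edge-∈-vars : ∀ (H : Graph n) {e} → e ∈ edges H → inj₂ e ∈ vars H
  edge-∈-vars H e∈H = ∈.∈-++⁺ʳ (map inj₁ (allFin n)) (∈.∈-map⁺ inj₂ e∈H)

  factor-homogeneous : ∀ (H : Graph n) e → All (HomogeneousTerm (vars H) 1) (factor H e)
  factor-homogeneous H (u , v) = All.++⁺ (Lform-homogeneous u) (All.map⁺ (Lform-homogeneous v))
    where
    Lform-homogeneous : ∀ u → All (HomogeneousTerm (vars H) 1) (Lform H u)
    Lform-homogeneous u = All.++⁺
      (All.concat⁺ (All.map⁺ (All.map (λ e∈H → ((edge-∈-vars H e∈H ∷ []) , refl) ∷ [])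
                                      (All.filter⁺ (incident? u) (All.tabulate (λ e∈H → e∈H))))))
      (((vertex-∈-vars H u ∷ []) , refl) ∷ [])

  vars-unique : ∀ (H : Graph n) → Unique (vars H)
  vars-unique H = Unique.++⁺ (Unique.map⁺ inj₁-injective (Unique.allFin⁺ n))
                             (Unique.map⁺ inj₂-injective (unique H)) disjoint
    where
    disjoint : ∀ {z} → ¬ (z ∈ map inj₁ (allFin n) × z ∈ map inj₂ (edges H))
    disjoint (z∈V , z∈E) with ∈.∈-map⁻ inj₁ z∈V | ∈.∈-map⁻ inj₂ z∈E
    ... | _ , _ , refl | _ , _ , ()

  sum-map-+ : ∀ (f g : Var n → ℕ) V → sum (map (λ z → f z + g z) V) ≡ sum (map f V) + sum (map g V)
  sum-map-+ f g []      = refl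
  sum-map-+ f g (z ∷ V) =
    trans (cong (f z + g z +_) (sum-map-+ f g V))
          (interchange ℕ.+-commutativeSemigroup (f z) (g z) _ _)

  sum-map-zero : ∀ {f : Var n → ℕ} {V} → All (λ z → f z ≡ 0) V → sum (map f V) ≡ 0
  sum-map-zero []           = refl
  sum-map-zero (fz≡0 ∷ eqs) = cong₂ _+_ fz≡0 (sum-map-zero eqs)

  sum-count-singleton : ∀ {V x} → Unique V → x ∈ V → sum (map (λ z → count z (x ∷ [])) V) ≡ 1
  sum-count-singleton {x ∷ V} (x∉V ∷ _) (here refl) =
    cong₂ _+_ (cong length (filter-accept (x ≟ⱽ_) refl))
              (sum-map-zero (All.map (λ x≢z → count-singleton-≢ (x≢z ∘ sym)) x∉V))
  sum-count-singleton {y ∷ V} (y∉V ∷ uV) (there x∈V) =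
    cong₂ _+_ (count-singleton-≢ (All.lookup y∉V x∈V)) (sum-count-singleton uV x∈V)

  sum-count : ∀ {V} → Unique V → ∀ {m} → All (_∈ V) m → sum (map (λ z → count z m) V) ≡ length m
  sum-count {V} uV {[]}    []           = sum-map-zero (All.universal (λ _ → refl) V)
  sum-count {V} uV {x ∷ m} (x∈V ∷ m⊆V) = begin
    sum (map (λ z → count z (x ∷ m)) V)
      ≡⟨ cong sum (map-cong (λ z → count-++ z (x ∷ []) m) V) ⟩
    sum (map (λ z → count z (x ∷ []) + count z m) V)
      ≡⟨ sum-map-+ (λ z → count z (x ∷ [])) (λ z → count z m) V ⟩
    sum (map (λ z → count z (x ∷ [])) V) + sum (map (λ z → count z m) V)
      ≡⟨ cong₂ _+_ (sum-count-singleton uV x∈V) (sum-count uV m⊆V) ⟩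
    suc (length m) ∎

  coeff≢0⇒valid : ∀ (H : Graph n) {β} → coeff H β ≢ 0ℤ → Valid H β
  coeff≢0⇒valid H {β} cβ≢0 with coeffOf≢0⇒matching H (P H) cβ≢0
  ... | t , t∈P , mt with All.lookup (prod-homogeneous (factor-homogeneous H) (edges H)) t∈P
  ...   | m⊆V , |m|≡|E| = begin
    sum (map β (vars H))                        ≡⟨ cong sum (map-cong-local (All.map sym mt)) ⟩
    sum (map (λ z → count z (proj₂ t)) (vars H)) ≡⟨ sum-count (vars-unique H) m⊆V ⟩
    length (proj₂ t)                             ≡⟨ |m|≡|E| ⟩
    length (edges H)                             ∎

-- Deleting a set of edges

filter-comm : ∀ {A : Set} {P Q : A → Set} (P? : Decidable P) (Q? : Decidable Q) xs →
              filter P? (filter Q? xs) ≡ filter Q? (filter P? xs)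
filter-comm P? Q? []       = refl
filter-comm {P = P} {Q} P? Q? (x ∷ xs) = go (P? x) (Q? x)
  where
  go : Dec (P x) → Dec (Q x) → filter P? (filter Q? (x ∷ xs)) ≡ filter Q? (filter P? (x ∷ xs))
  go (yes px) (yes qx)
    rewrite filter-accept Q? {xs = xs} qx | filter-accept P? {xs = filter Q? xs} px
          | filter-accept P? {xs = xs} px | filter-accept Q? {xs = filter P? xs} qx
    = cong (x ∷_) (filter-comm P? Q? xs)
  go (yes px) (no ¬qx)
    rewrite filter-reject Q? {xs = xs} ¬qx | filter-accept P? {xs = xs} px
          | filter-reject Q? {xs = filter P? xs} ¬qx
    = filter-comm P? Q? xs
  go (no ¬px) (yes qx)
    rewrite filter-accept Q? {xs = xs} qx | filter-reject P? {xs = filter Q? xs} ¬px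
          | filter-reject P? {xs = xs} ¬px
    = filter-comm P? Q? xs
  go (no ¬px) (no ¬qx)
    rewrite filter-reject Q? {xs = xs} ¬qx | filter-reject P? {xs = xs} ¬px
    = filter-comm P? Q? xs

module DeleteEdges {n : ℕ} (G : Graph n) (E' : List (Edge n)) where

  deleted? : Decidable (_∈ E')
  deleted? e = mem? _≟ᴱ_ e E'

  Deleted : Var n → Set
  Deleted (inj₁ _) = ⊥
  Deleted (inj₂ e) = e ∈ E'

  Deleted? : Decidable Deleted
  Deleted? (inj₁ _) = no λ ()
  Deleted? (inj₂ e) = deleted? e

  open Zeroing Deleted?

  K : Graph n
  K = G ∖ E'

  edgeVars : List (Edge n) → Poly n
  edgeVars = concatMap (λ e → pvar (inj₂ e))

  zeroed-edgeVars : ∀ es → zeroed (edgeVars es) ≡ edgeVars (filter (¬? ∘ deleted?) es)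
  zeroed-edgeVars []       = refl
  zeroed-edgeVars (e ∷ es) with deleted? e
  ... | yes _ = zeroed-edgeVars es
  ... | no  _ = cong (_ ∷_) (zeroed-edgeVars es)

  zeroed-Lform : ∀ u → zeroed (Lform G u) ≡ Lform K u
  zeroed-Lform u = begin
    zeroed (edgeVars (filter (incident? u) (edges G)) ++ pvar (inj₁ u))
      ≡⟨ filter-++ (avoids? ∘ proj₂) (edgeVars (filter (incident? u) (edges G))) _ ⟩
    zeroed (edgeVars (filter (incident? u) (edges G))) ++ pvar (inj₁ u)
      ≡⟨ cong (_++ pvar (inj₁ u)) (zeroed-edgeVars (filter (incident? u) (edges G))) ⟩
    edgeVars (filter (¬? ∘ deleted?) (filter (incident? u) (edges G))) ++ pvar (inj₁ u)
      ≡⟨ cong (λ es → edgeVars es ++ pvar (inj₁ u))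
              (filter-comm (¬? ∘ deleted?) (incident? u) (edges G)) ⟩
    edgeVars (filter (incident? u) (edges K)) ++ pvar (inj₁ u) ∎

  zeroed-factor : ∀ e → zeroed (factor G e) ≡ factor K e
  zeroed-factor (u , v) =
    trans (filter-++ (avoids? ∘ proj₂) (Lform G u) _)
          (cong₂ _++_ (zeroed-Lform u)
                      (trans (zeroed-pneg (Lform G v)) (cong pneg (zeroed-Lform v))))

  vars-∖-⊆ : vars K ⊆ vars G
  vars-∖-⊆ = ⊆.++⁺ʳ (map inj₁ (allFin n)) (⊆.map⁺ inj₂ (⊆.filter-⊆ (¬? ∘ deleted?) (edges G)))

  vars-∖-cover : ∀ {z} → z ∈ vars G → z ∈ vars K ⊎ Deleted z
  vars-∖-cover z∈G with ∈.∈-++⁻ (map inj₁ (allFin n)) z∈G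
  ... | inj₁ z∈V = inj₁ (∈.∈-++⁺ˡ z∈V)
  ... | inj₂ z∈E with ∈.∈-map⁻ inj₂ z∈E
  ...   | e , e∈G , refl with deleted? e
  ...     | yes e∈E' = inj₂ e∈E'
  ...     | no  e∉E' = inj₁ (edge-∈-vars K (∈.∈-filter⁺ (¬? ∘ deleted?) e∈G e∉E'))

  deleted-∈-vars : E' ⊆ edges G → ∀ {z} → Deleted z → z ∈ vars G
  deleted-∈-vars E'⊆G {inj₂ e} e∈E' = edge-∈-vars G (E'⊆G e∈E')

  deletedFactors : Poly n
  deletedFactors = prod (factor K) (filter deleted? (edges G))

  coeff-∖ : E' ⊆ edges G → ∀ {α} → (∀ {z} → Deleted z → α z ≡ 0) →
            coeff G α ≡ coeffOf K α (pmul deletedFactors (P K))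
  coeff-∖ E'⊆G {α} α-deleted = begin
    coeff G α
      ≡⟨ sym (coeffOf-zeroed G (deleted-∈-vars E'⊆G) α-deleted (P G)) ⟩
    coeffOf G α (zeroed (P G))
      ≡⟨ coeffOf-zeroed-vars G K vars-∖-⊆ vars-∖-cover α-deleted (P G) ⟩
    coeffOf K α (zeroed (P G))
      ≡⟨ cong (coeffOf K α) (zeroed-prod (factor G) (factor K) zeroed-factor (edges G)) ⟩
    coeffOf K α (prod (factor K) (edges G))
      ≡⟨ prod-partition K (factor K) deleted? (edges G) α ⟩
    coeffOf K α (pmul deletedFactors (P K)) ∎

lemma8 : ∀ {n} (G : Graph n) (η : IndexFn n) (E' : List (Edge n)) →
    NonSingular G η →
    E' ⊆ edges G →
    All (λ e → η (inj₂ e) ≡ 0) E' →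
    NonSingular (G ∖ E') η
lemma8 G η E' (α , _ , α≤η , cα≢0) E'⊆G η-E'≡0 = α ∸ᵐ m , coeff≢0⇒valid K cβ≢0 , β≤η , cβ≢0
  where
  open DeleteEdges G E'

  α-deleted : ∀ {z} → Deleted z → α z ≡ 0
  α-deleted {inj₂ e} e∈E' =
    ℕ.n≤0⇒n≡0 (subst (α (inj₂ e) ≤_) (All.lookup η-E'≡0 e∈E')
                                     (All.lookup α≤η (deleted-∈-vars E'⊆G e∈E')))

  witness : ∃ λ m → coeff K (α ∸ᵐ m) ≢ 0ℤ
  witness = coeffOf-pmul≢0 K deletedFactors (P K) (cα≢0 ∘ trans (coeff-∖ E'⊆G α-deleted))

  m : List (Var _)
  m = proj₁ witness

  cβ≢0 : coeff K (α ∸ᵐ m) ≢ 0ℤ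
  cβ≢0 = proj₂ witness

  β≤η : (α ∸ᵐ m) ≤[ K ] η
  β≤η = All.anti-mono vars-∖-⊆ (All.map (λ {z} → ℕ.≤-trans (ℕ.m∸n≤m (α z) (count z m))) α≤η)
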